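{- Let $X\in\{\mathrm{K4\times S5},\mathrm{S4\times S5},\mathrm{SSL}\}$, let $\varphi$ be a bimodal formula and let $M=(W,\stackrel{\Diamond}{\to},\stackrel{L}{\to},\sigma)$ be an $X$-model. For $w\in W$ let $sat_\varphi(w)=\{\psi\in\mathrm{sf}(\varphi): M,w\models\psi\}$; for an $\stackrel{L}{\to}$-equivalence class $q$ let $\mathcal{F}_q=\{sat_\varphi(w):w\in q\}$; and let $\mathfrak{T}_{M,\varphi}=\{\mathcal{F}_q: q\in W_{\stackrel{L}{\to}}\}$. Then: (1) for all $w\in W$, $sat_\varphi(w)$ is an $X$-tableau-set with respect to $\varphi$; (2) for all $u,v\in W$, $u\stackrel{\Diamond}{\to}v$ implies $sat_\varphi(u)\preccurlyeq_X sat_\varphi(v)$; (3) for all $q\in W_{\stackrel{L}{\to}}$, $\mathcal{F}_q$ is an $X$-tableau-cloud with respect to $\varphi$; (4) for all $p,q\in W_{\stackrel{L}{\to}}$, if there are $w\in p$, $v\in q$ with $w\stackrel{\Diamond}{\to}v$, then $\mathcal{F}_p\leq_X\mathcal{F}_q$; (5) for all $w\in W$, $\mathfrak{T}_{M,\varphi}$ is a partial $X$-tableau for $(\varphi,\mathcal{F}_{[w]_L})$, where $[w]_L$ is the $\stackrel{L}{\to}$-class of $w$.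
   Context: Bimodal formulas are built from propositional variables (set $AT$) by $\neg$, $\wedge$, $K$, $\Box$. $\mathrm{sf}(\varphi)$ is the set of subformulas; $\mathcal{L}_\Box$ (resp. $\mathcal{L}_K$) is the set of formulas of the form $\Box\chi$ (resp. $K\chi$). $W_{\stackrel{L}{\to}}$ is the set of $\stackrel{L}{\to}$-classes. Models: $M=(W,\stackrel{\Diamond}{\to},\stackrel{L}{\to},\sigma)$, $\sigma:AT\to\mathcal{P}(W)$, usual semantics ($\Box$ over $\stackrel{\Diamond}{\to}$-successors, $K$ over $\stackrel{L}{\to}$-successors). Left commutativity: if $w\stackrel{\Diamond}{\to}u\stackrel{L}{\to}u'$ then $w\stackrel{L}{\to}w'\stackrel{\Diamond}{\to}u'$ for some $w'$; right commutativity: if $w\stackrel{L}{\to}w'\stackrel{\Diamond}{\to}u'$ then $w\stackrel{\Diamond}{\to}u\stackrel{L}{\to}u'$ for some $u$. A $\mathrm{K4\times S5}$-model has $\stackrel{\Diamond}{\to}$ transitive, $\stackrel{L}{\to}$ an equivalence, both commutativities; an $\mathrm{S4\times S5}$-model additionally has $\stackrel{\Diamond}{\to}$ reflexive; an $\mathrm{SSL}$-model has $\stackrel{\Diamond}{\to}$ a preorder, $\stackrel{L}{\to}$ an equivalence, left commutativity, and persistence ($w\stackrel{\Diamond}{\to}v$ implies $w\in\sigma(A)\iff v\in\sigma(A)$ for $A\in AT$). A $\mathrm{K4\times S5}$-tableau-set w.r.t. $\varphi$ is $F\subseteq\mathrm{sf}(\varphi)$ with (a) $\neg\chi\in F\iff\chi\notin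 F$; (b) $(\chi_1\wedge\chi_2)\in F\iff\chi_1,\chi_2\in F$; (c) $K\chi\in F\Rightarrow\chi\in F$ (for formulas in $\mathrm{sf}(\varphi)$); $\mathrm{S4\times S5}$-/$\mathrm{SSL}$-tableau-sets also satisfy (d) $\Box\chi\in F\Rightarrow\chi\in F$. $\mathcal{T}^X_\varphi$ = set of $X$-tableau-sets. An $X$-tableau-cloud is $\mathcal{F}\subseteq\mathcal{T}^X_\varphi$ with $F\cap\mathcal{L}_K=G\cap\mathcal{L}_K$ for $F,G\in\mathcal{F}$ and, for $K\chi\in\mathrm{sf}(\varphi)$, $\chi\in\bigcap\mathcal{F}\Rightarrow K\chi\in\bigcap\mathcal{F}$. $\mathfrak{C}^X_\varphi$ = set of clouds. $F\preccurlyeq_X G$: for $\mathrm{K4\times S5}$, $F\cap\mathcal{L}_\Box\subseteq G$ and $\{\psi:\Box\psi\in F\}\subseteq G$; for $\mathrm{S4\times S5}$, $F\cap\mathcal{L}_\Box\subseteq G$; for $\mathrm{SSL}$, $F\cap\mathcal{L}_\Box\subseteq G$ and $F\cap AT=G\cap AT$. $\mathcal{F}\leq_X\mathcal{G}$: every $G\in\mathcal{G}$ has $F\in\mathcal{F}$ with $F\preccurlyeq_X G$, and (only for $X\neq\mathrm{SSL}$) every $F\in\mathcal{F}$ has $G\in\mathcal{G}$ with $F\preccurlyeq_X G$. A partial $X$-tableau for $(\varphi,\mathcal{F}_0)$, $\mathcal{F}_0\in\mathfrak{C}^X_\varphi$, is a set $\mathfrak{T}\subseteq\mathfrak{C}^X_\varphi$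 with $\mathcal{F}_0\in\mathfrak{T}$ such that for all $\mathcal{F}\in\mathfrak{T}$, all $F\in\mathcal{F}$ and all $\chi$ with $\Box\chi\in\mathrm{sf}(\varphi)\setminus F$ there are $\mathcal{G}\in\mathfrak{T}$ with $\mathcal{F}\leq_X\mathcal{G}$ and $G\in\mathcal{G}$ with $F\preccurlyeq_X G$ and $\chi\notin G$. -}

module Defs where

open import Data.Product using (Σ; Σ-syntax; ∃; _×_; _,_; proj₁; proj₂)
open import Relation.Nullary using (¬_)
open import Relation.Binary.Definitions using (Reflexive; Transitive)
open import Relation.Binary.Structures using (IsEquivalence)
open import Function.Bundles using (_⇔_)
open import Data.Empty using (⊥)
open import Data.Unit using (⊤)

data Form (AT : Set) : Set where
  var  : AT → Form AT
  ~_   : Form AT → Form AT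
  _∧_  : Form AT → Form AT → Form AT
  K_   : Form AT → Form AT
  □_   : Form AT → Form AT

infix 30 ~_ K_ □_
infixr 20 _∧_

data _∈sf_ {AT : Set} : Form AT → Form AT → Set where
  here : ∀ {φ} → φ ∈sf φ
  in~  : ∀ {ψ χ} → ψ ∈sf χ → ψ ∈sf (~ χ)
  in∧ˡ : ∀ {ψ χ₁ χ₂} → ψ ∈sf χ₁ → ψ ∈sf (χ₁ ∧ χ₂)
  in∧ʳ : ∀ {ψ χ₁ χ₂} → ψ ∈sf χ₂ → ψ ∈sf (χ₁ ∧ χ₂)
  inK  : ∀ {ψ χ} → ψ ∈sf χ → ψ ∈sf (K χ)
  in□  : ∀ {ψ χ} → ψ ∈sf χ → ψ ∈sf (□ χ)

FSet : Set → Set₁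
FSet AT = Form AT → Set

data Logic : Set where
  K4×S5 S4×S5 SSL : Logic

record Model (AT : Set) : Set₁ where
  field
    W   : Set
    _→◇_ : W → W → Set
    _→L_ : W → W → Set
    σ   : AT → W → Set

module _ {AT : Set} (M : Model AT) where
  open Model M

  _⊨_ : W → Form AT → Set
  w ⊨ var A   = σ A w
  w ⊨ (~ χ)   = ¬ (w ⊨ χ)
  w ⊨ (χ ∧ ψ) = (w ⊨ χ) × (w ⊨ ψ)
  w ⊨ (K χ)   = ∀ v → w →L v → v ⊨ χ
  w ⊨ (□ χ)   = ∀ v → w →◇ v → v ⊨ χ

  LeftComm : Set
  LeftComm = ∀ {w u u'} → w →◇ u → u →L u' → Σ[ w' ∈ W ] (w →L w' × w' →◇ u')

  RightComm : Set
  RightComm = ∀ {w w' u'} → w →L w' → w' →◇ u' → Σ[ u ∈ W ] (w →◇ u × u →L u')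

  Persistent : Set
  Persistent = ∀ {w v} → w →◇ v → ∀ A → (σ A w ⇔ σ A v)

  IsModel : Logic → Set
  IsModel K4×S5 = Transitive _→◇_ × IsEquivalence _→L_ × LeftComm × RightComm
  IsModel S4×S5 = Reflexive _→◇_ × Transitive _→◇_ × IsEquivalence _→L_
                  × LeftComm × RightComm
  IsModel SSL   = Reflexive _→◇_ × Transitive _→◇_ × IsEquivalence _→L_
                  × LeftComm × Persistent

module _ {AT : Set} where

  BoxT : Logic → Form AT → FSet AT → Set
  BoxT K4×S5 φ F = ⊤
  BoxT S4×S5 φ F = ∀ χ → (□ χ) ∈sf φ → F (□ χ) → F χ
  BoxT SSL   φ F = ∀ χ → (□ χ) ∈sf φ → F (□ χ) → F χ

  record TableauSet (X : Logic) (φ : Form AT) (F : FSet AT) : Set where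
    field
      ⊆sf   : ∀ ψ → F ψ → ψ ∈sf φ
      neg   : ∀ χ → (~ χ) ∈sf φ → (F (~ χ) ⇔ (¬ F χ))
      conj  : ∀ χ₁ χ₂ → (χ₁ ∧ χ₂) ∈sf φ → (F (χ₁ ∧ χ₂) ⇔ (F χ₁ × F χ₂))
      Kref  : ∀ χ → (K χ) ∈sf φ → F (K χ) → F χ
      boxT  : BoxT X φ F

  _⊢_≼_ : Logic → FSet AT → FSet AT → Set
  K4×S5 ⊢ F ≼ G = (∀ χ → F (□ χ) → G (□ χ)) × (∀ ψ → F (□ ψ) → G ψ)
  S4×S5 ⊢ F ≼ G = ∀ χ → F (□ χ) → G (□ χ)
  SSL   ⊢ F ≼ G = (∀ χ → F (□ χ) → G (□ χ)) × (∀ A → (F (var A) ⇔ G (var A)))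

  -- A set of formula-sets, given as an indexed family
  Cloud : Set₁
  Cloud = Σ[ I ∈ Set ] (I → FSet AT)

  record IsCloud (X : Logic) (φ : Form AT) (𝓕 : Cloud) : Set where
    field
      tabl   : ∀ i → TableauSet X φ (proj₂ 𝓕 i)
      sameK  : ∀ i j χ → proj₂ 𝓕 i (K χ) → proj₂ 𝓕 j (K χ)
      Kclose : ∀ χ → (K χ) ∈sf φ → (∀ i → proj₂ 𝓕 i χ) → ∀ i → proj₂ 𝓕 i (K χ)

  Forth : Logic → Cloud → Cloud → Set
  Forth K4×S5 𝓕 𝓖 = ∀ i → Σ[ j ∈ proj₁ 𝓖 ] (K4×S5 ⊢ proj₂ 𝓕 i ≼ proj₂ 𝓖 j)
  Forth S4×S5 𝓕 𝓖 = ∀ i → Σ[ j ∈ proj₁ 𝓖 ] (S4×S5 ⊢ proj₂ 𝓕 i ≼ proj₂ 𝓖 j)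
  Forth SSL   𝓕 𝓖 = ⊤

  _⊢_≤_ : Logic → Cloud → Cloud → Set
  X ⊢ 𝓕 ≤ 𝓖 = (∀ j → Σ[ i ∈ proj₁ 𝓕 ] (X ⊢ proj₂ 𝓕 i ≼ proj₂ 𝓖 j)) × Forth X 𝓕 𝓖

  -- 𝔗 (a set of clouds, indexed by J) is a partial X-tableau for (φ, 𝔗 j₀)
  record IsPartialTableau (X : Logic) (φ : Form AT) {J : Set} (𝔗 : J → Cloud) (j₀ : J) : Set where
    field
      clouds : ∀ j → IsCloud X φ (𝔗 j)
      wit    : ∀ j (i : proj₁ (𝔗 j)) χ → (□ χ) ∈sf φ → ¬ proj₂ (𝔗 j) i (□ χ) →
               Σ[ j' ∈ J ] ((X ⊢ 𝔗 j ≤ 𝔗 j') ×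
                 Σ[ i' ∈ proj₁ (𝔗 j') ] ((X ⊢ proj₂ (𝔗 j) i ≼ proj₂ (𝔗 j') i')
                                          × ¬ proj₂ (𝔗 j') i' χ))

open Model public using (W; _→◇_; _→L_; σ)

module _ {AT : Set} (φ : Form AT) (M : Model AT) where
  open Model M renaming (W to W'; _→L_ to _≈L_)

  sat : W' → FSet AT
  sat w ψ = (ψ ∈sf φ) × _⊨_ M w ψ

  -- 𝓕_q for q = [w]_L
  cloudOf : W' → Cloud
  cloudOf w = (Σ[ w' ∈ W' ] (w ≈L w')) , (λ p → sat (proj₁ p))

  -- 𝔗_{M,φ}, indexed by representatives of the L-classes
  𝔗M : W' → Cloud
  𝔗M = cloudOf

-- Each clause of the
-- lemma is a property of the model transported to formula sets:
--   * sat w is a tableau-set because the truth conditions of ¬ and ∧ are the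
--     tableau conditions, and reflexivity of →L (resp. →◇) validates K χ → χ
--     (resp. □ χ → χ);
--   * u →◇ v gives sat u ≼ sat v by transitivity of →◇ (□-formulas persist),
--     by the semantics of □ (K4×S5) and by persistence of atoms (SSL);
--   * the sets sat w' with w' in one L-class form a cloud since →L is an
--     equivalence, so K-formulas are constant on the class;
--   * the back clause of ≤ follows from left commutativity, the forth
--     clause (K4×S5, S4×S5 only) from right commutativity;
--   * a false □ χ has, by excluded middle, a →◇-successor refuting χ; its
--     L-class is the cloud required by the partial-tableau condition.
module Submission where

open import Defs
open import Data.Product using (Σ; Σ-syntax; _×_; _,_; proj₁; proj₂)
open import Data.Unit using (tt)
open import Level using (0ℓ)
open import Axiom.ExcludedMiddle using (ExcludedMiddle)
open import Axiom.DoubleNegationElimination using (em⇒dne)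
open import Relation.Nullary using (¬_)
open import Relation.Binary.Definitions using (Reflexive; Transitive)
open import Relation.Binary.Structures using (IsEquivalence)
open import Function.Bundles using (_⇔_; mk⇔; Equivalence)

∈sf-trans : ∀ {AT} {ψ χ φ : Form AT} → ψ ∈sf χ → χ ∈sf φ → ψ ∈sf φ
∈sf-trans p here     = p
∈sf-trans p (in~ q)  = in~ (∈sf-trans p q)
∈sf-trans p (in∧ˡ q) = in∧ˡ (∈sf-trans p q)
∈sf-trans p (in∧ʳ q) = in∧ʳ (∈sf-trans p q)
∈sf-trans p (inK q)  = inK (∈sf-trans p q)
∈sf-trans p (in□ q)  = in□ (∈sf-trans p q)

module SatisfiedSubformulas {AT : Set} (φ : Form AT) (M : Model AT) where
  open Model M renaming (W to World; _→◇_ to _↝_; _→L_ to _∼_)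

  _⊩_ : World → Form AT → Set
  _⊩_ = _⊨_ M

  Linked : World → World → Set
  Linked p q = Σ[ w ∈ World ] Σ[ v ∈ World ] (p ∼ w × q ∼ v × w ↝ v)

  sat-tableauSet : (X : Logic) → Reflexive _∼_ →
    (∀ w → BoxT X φ (sat φ M w)) → ∀ w → TableauSet X φ (sat φ M w)
  sat-tableauSet X ∼-refl boxT w = record
    { ⊆sf  = λ ψ → proj₁
    ; neg  = λ χ ~χ∈φ → mk⇔ (λ { (_ , w⊮χ) (_ , w⊩χ) → w⊮χ w⊩χ })
                            (λ ¬satχ → ~χ∈φ , λ w⊩χ → ¬satχ (∈sf-trans (in~ here) ~χ∈φ , w⊩χ))
    ; conj = λ χ₁ χ₂ ∧∈φ → mk⇔
        (λ { (_ , w⊩χ₁ , w⊩χ₂) → (∈sf-trans (in∧ˡ here) ∧∈φ , w⊩χ₁)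
                               , (∈sf-trans (in∧ʳ here) ∧∈φ , w⊩χ₂) })
        (λ { ((_ , w⊩χ₁) , (_ , w⊩χ₂)) → ∧∈φ , w⊩χ₁ , w⊩χ₂ })
    ; Kref = λ χ Kχ∈φ (_ , w⊩Kχ) → ∈sf-trans (inK here) Kχ∈φ , w⊩Kχ w ∼-refl
    ; boxT = boxT w }

  sat-boxT : Reflexive _↝_ → ∀ w χ → (□ χ) ∈sf φ → sat φ M w (□ χ) → sat φ M w χ
  sat-boxT ↝-refl w χ □χ∈φ (_ , w⊩□χ) = ∈sf-trans (in□ here) □χ∈φ , w⊩□χ w ↝-refl

  sat-□-persists : Transitive _↝_ → ∀ {u v} → u ↝ v →
    ∀ χ → sat φ M u (□ χ) → sat φ M v (□ χ)
  sat-□-persists ↝-trans u↝v χ (□χ∈φ , u⊩□χ) = □χ∈φ , λ x v↝x → u⊩□χ x (↝-trans u↝v v↝x)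

  sat-□-elim : ∀ {u v} → u ↝ v → ∀ ψ → sat φ M u (□ ψ) → sat φ M v ψ
  sat-□-elim {v = v} u↝v ψ (□ψ∈φ , u⊩□ψ) = ∈sf-trans (in□ here) □ψ∈φ , u⊩□ψ v u↝v

  sat-atoms-persist : Persistent M → ∀ {u v} → u ↝ v →
    ∀ A → sat φ M u (var A) ⇔ sat φ M v (var A)
  sat-atoms-persist persist u↝v A = mk⇔
    (λ { (A∈φ , u⊩A) → A∈φ , Equivalence.to   (persist u↝v A) u⊩A })
    (λ { (A∈φ , v⊩A) → A∈φ , Equivalence.from (persist u↝v A) v⊩A })

  module _ (∼-equiv : IsEquivalence _∼_) where
    open IsEquivalence ∼-equiv renaming (refl to ∼-refl; sym to ∼-sym; trans to ∼-trans)

    -- Clause (3): an L-class of tableau-sets is a cloud, since K-formulas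
    -- quantify over the whole class.
    cloudOf-isCloud : (X : Logic) → (∀ w → TableauSet X φ (sat φ M w)) →
      ∀ q → IsCloud X φ (cloudOf φ M q)
    cloudOf-isCloud X tableau q = record
      { tabl   = λ i → tableau (proj₁ i)
      ; sameK  = λ { (_ , q∼i) (_ , q∼j) χ (Kχ∈φ , i⊩Kχ) →
                     Kχ∈φ , λ x j∼x → i⊩Kχ x (∼-trans (∼-trans (∼-sym q∼i) q∼j) j∼x) }
      ; Kclose = λ { χ Kχ∈φ χ-everywhere (_ , q∼i) →
                     Kχ∈φ , λ x i∼x → proj₂ (χ-everywhere (x , ∼-trans q∼i i∼x)) } }

    linked-back : LeftComm M → (_≼_ : FSet AT → FSet AT → Set) →
      (∀ u v → u ↝ v → sat φ M u ≼ sat φ M v) →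
      ∀ p q → Linked p q → ∀ (j : Σ[ v' ∈ World ] (q ∼ v')) →
      Σ[ i ∈ Σ[ u' ∈ World ] (p ∼ u') ] (sat φ M (proj₁ i) ≼ sat φ M (proj₁ j))
    linked-back leftComm _≼_ step p q (w , v , p∼w , q∼v , w↝v) (v' , q∼v')
      with leftComm w↝v (∼-trans (∼-sym q∼v) q∼v')
    ... | w' , w∼w' , w'↝v' = (w' , ∼-trans p∼w w∼w') , step w' v' w'↝v'

    linked-forth : RightComm M → (_≼_ : FSet AT → FSet AT → Set) →
      (∀ u v → u ↝ v → sat φ M u ≼ sat φ M v) →
      ∀ p q → Linked p q → ∀ (i : Σ[ u' ∈ World ] (p ∼ u')) →
      Σ[ j ∈ Σ[ v' ∈ World ] (q ∼ v') ] (sat φ M (proj₁ i) ≼ sat φ M (proj₁ j))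
    linked-forth rightComm _≼_ step p q (w , v , p∼w , q∼v , w↝v) (u' , p∼u')
      with rightComm (∼-trans (∼-sym p∼u') p∼w) w↝v
    ... | x , u'↝x , x∼v = (x , ∼-trans q∼v (∼-sym x∼v)) , step u' x u'↝x

    -- A false subformula □ χ is refuted by some →◇-successor; this is the
    -- one classical step of the lemma.
    □-counterexample : ExcludedMiddle 0ℓ → ∀ u χ → (□ χ) ∈sf φ →
      ¬ sat φ M u (□ χ) → Σ[ v ∈ World ] (u ↝ v × ¬ (v ⊩ χ))
    □-counterexample em u χ □χ∈φ ¬sat□χ =
      dne λ no-counterexample → ¬sat□χ
        (□χ∈φ , λ v u↝v → dne λ v⊮χ → no-counterexample (v , u↝v , v⊮χ))
      where
      dne : ∀ {P : Set} → ¬ ¬ P → P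
      dne = em⇒dne em

    -- Clause (5): given clauses (2)-(4), the L-classes form a partial tableau
    -- rooted at any class; the required cloud is the class of a counterexample.
    𝔗M-isPartialTableau : ExcludedMiddle 0ℓ → (X : Logic) →
      (∀ q → IsCloud X φ (cloudOf φ M q)) →
      (∀ u v → u ↝ v → X ⊢ sat φ M u ≼ sat φ M v) →
      (∀ p q → Linked p q → X ⊢ cloudOf φ M p ≤ cloudOf φ M q) →
      ∀ w → IsPartialTableau X φ (𝔗M φ M) w
    𝔗M-isPartialTableau em X isCloud step ≤-linked w = record
      { clouds = isCloud
      ; wit    = λ { q (u , q∼u) χ □χ∈φ ¬sat□χ →
          let (v , u↝v , v⊮χ) = □-counterexample em u χ □χ∈φ ¬sat□χ in
          v , ≤-linked q v (u , v , q∼u , ∼-refl , u↝v)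
            , (v , ∼-refl) , step u v u↝v , λ satχ → v⊮χ (proj₂ satχ) } }

    lemma6p2-from : ExcludedMiddle 0ℓ → (X : Logic) → LeftComm M →
      (∀ w → BoxT X φ (sat φ M w)) →
      (∀ u v → u ↝ v → X ⊢ sat φ M u ≼ sat φ M v) →
      (∀ p q → Linked p q → Forth X (cloudOf φ M p) (cloudOf φ M q)) →
      ((w : World) → TableauSet X φ (sat φ M w))
      × ((u v : World) → u ↝ v → X ⊢ sat φ M u ≼ sat φ M v)
      × ((q : World) → IsCloud X φ (cloudOf φ M q))
      × ((p q : World) → Linked p q → X ⊢ cloudOf φ M p ≤ cloudOf φ M q)
      × ((w : World) → IsPartialTableau X φ (𝔗M φ M) w)
    lemma6p2-from em X leftComm boxT step forth =
      tableau , step , isCloud , ≤-linked , 𝔗M-isPartialTableau em X isCloud step ≤-linked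
      where
      tableau : ∀ w → TableauSet X φ (sat φ M w)
      tableau = sat-tableauSet X ∼-refl boxT
      isCloud : ∀ q → IsCloud X φ (cloudOf φ M q)
      isCloud = cloudOf-isCloud X tableau
      ≤-linked : ∀ p q → Linked p q → X ⊢ cloudOf φ M p ≤ cloudOf φ M q
      ≤-linked p q pq = linked-back leftComm (X ⊢_≼_) step p q pq , forth p q pq

lemma6p2 : ExcludedMiddle 0ℓ → {AT : Set} (X : Logic) (φ : Form AT) (M : Model AT) →
    IsModel M X →
    ((w : W M) → TableauSet X φ (sat φ M w))
    × ((u v : W M) → _→◇_ M u v → X ⊢ sat φ M u ≼ sat φ M v)
    × ((q : W M) → IsCloud X φ (cloudOf φ M q))
    × ((p q : W M) → Σ[ w ∈ W M ] Σ[ v ∈ W M ] (_→L_ M p w × _→L_ M q v × _→◇_ M w v) →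
    X ⊢ cloudOf φ M p ≤ cloudOf φ M q)
    × ((w : W M) → IsPartialTableau X φ (𝔗M φ M) w)
lemma6p2 em K4×S5 φ M (↝-trans , ∼-equiv , leftComm , rightComm) =
  lemma6p2-from ∼-equiv em K4×S5 leftComm (λ _ → tt) step
    (linked-forth ∼-equiv rightComm (K4×S5 ⊢_≼_) step)
  where
  open SatisfiedSubformulas φ M
  step : ∀ u v → _→◇_ M u v → K4×S5 ⊢ sat φ M u ≼ sat φ M v
  step u v u↝v = sat-□-persists ↝-trans u↝v , sat-□-elim u↝v
lemma6p2 em S4×S5 φ M (↝-refl , ↝-trans , ∼-equiv , leftComm , rightComm) =
  lemma6p2-from ∼-equiv em S4×S5 leftComm (sat-boxT ↝-refl) step
    (linked-forth ∼-equiv rightComm (S4×S5 ⊢_≼_) step)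
  where
  open SatisfiedSubformulas φ M
  step : ∀ u v → _→◇_ M u v → S4×S5 ⊢ sat φ M u ≼ sat φ M v
  step u v u↝v = sat-□-persists ↝-trans u↝v
lemma6p2 em SSL φ M (↝-refl , ↝-trans , ∼-equiv , leftComm , persist) =
  lemma6p2-from ∼-equiv em SSL leftComm (sat-boxT ↝-refl) step (λ _ _ _ → tt)
  where
  open SatisfiedSubformulas φ M
  step : ∀ u v → _→◇_ M u v → SSL ⊢ sat φ M u ≼ sat φ M v
  step u v u↝v = sat-□-persists ↝-trans u↝v , sat-atoms-persist persist u↝v
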